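{- Let $F$ be a sawed tree of height $n$. Then $F$ validates $\mathbf{PL}_n$.
   Context: A finite tree is a finite poset with a least element in which every ${\downarrow}x=\{y\mid y\le x\}$ is a chain. Height of a poset: maximum of $|X|-1$ over chains $X$; height of an element $x$: height of ${\downarrow}x$; $\mathrm{Top}$ denotes the set of maximal elements. Let $T$ be a finite tree of height $>0$ all of whose top elements have the same height, with a plane ordering $\prec$ of $\mathrm{Top}(T)$ (a linear order such that $\{y\ge x\}\cap\mathrm{Top}(T)$ is a $\prec$-interval for each $x\in T$), enumerated $t_1\prec\cdots\prec t_k$. The sawed tree based on $(T,\prec)$ is the poset obtained from $T$ by adding new elements $s_1,\dots,s_{k-1}$ with $t_i,t_{i+1}<s_i$ for each $i$ (and the order generated by transitivity). Formulas are intuitionistic; an intermediate logic contains $\mathbf{IPC}$ and is closed under modus ponens and substitution; Kripke frames are posets with intuitionistic validity. $\mathbf{BD}_n$ is the logic of all finite posets of height at most $n$. A p-morphism $f$ satisfies $f({\uparrow}x)={\uparrow}f(x)$. For a finite rooted poset $Q$, $\chi(Q)$ is its Jankov–Fine formula: a frame validates $\chi(Q)$ iff there is no surjective p-morphism from an upward-closed subset of it onto $Q$. $\mathrm{Fork}_3$ is a root with three pairwise incomparable elements above it; $\mathrm{Scott}$ is $\{r,a,b,c\}$ with $r<a<b$, $r<c$, $c$ incomparable with $a,b$. $\mathbf{PL}$ is the smallest intermediate logic containing $\chi(\mathrm{Fork}_3)$ and $\chi(\mathrm{Scott})$; $\mathbf{PL}_n$ the smallest containing $\mathbf{BD}_n\cup\mathbf{PL}$.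 -}

module Defs where

open import Data.Nat using (ℕ; zero; suc; _+_; _*_)
open import Data.Bool using (Bool; true; false; _∧_; _∨_; not; T; if_then_else_)
open import Data.Bool.Properties using (T-∨)
open import Data.Fin using (Fin; inject₁; _≟_) renaming (zero to fz; suc to fs; _≤_ to _≤ꟳ_)
open import Data.Vec using (Vec; []; _∷_; lookup; tabulate; zipWith; replicate)
open import Data.List using (List; []; _∷_; _++_; map; concatMap; filterᵇ; foldr; allFin)
open import Data.List.Membership.Propositional using (_∈_)
open import Data.Product using (Σ; _×_; _,_; ∃)
open import Data.Sum using (_⊎_; inj₁; inj₂)
open import Data.Unit using (⊤)
open import Data.Empty using (⊥)
open import Function using (Injective; _∘_)
open import Function.Bundles using (Equivalence)
open import Relation.Nullary using (¬_)
open import Relation.Nullary.Decidable using (⌊_⌋; toWitness; fromWitness)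
open import Relation.Binary.PropositionalEquality using (_≡_; _≢_; refl; cong; subst)

infixr 6 _∧'_
infixr 5 _∨'_
infixr 4 _⇒_

data Fm : Set where
  var  : ℕ → Fm
  ⊥'   : Fm
  _∧'_ : Fm → Fm → Fm
  _∨'_ : Fm → Fm → Fm
  _⇒_  : Fm → Fm → Fm

¬' : Fm → Fm
¬' φ = φ ⇒ ⊥'

⊤' : Fm
⊤' = ⊥' ⇒ ⊥'

_⇔'_ : Fm → Fm → Fm
φ ⇔' ψ = (φ ⇒ ψ) ∧' (ψ ⇒ φ)

⋀ : List Fm → Fm
⋀ = foldr _∧'_ ⊤'

sub : (ℕ → Fm) → Fm → Fm
sub σ (var p)  = σ p
sub σ ⊥'       = ⊥'
sub σ (φ ∧' ψ) = sub σ φ ∧' sub σ ψ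
sub σ (φ ∨' ψ) = sub σ φ ∨' sub σ ψ
sub σ (φ ⇒ ψ)  = sub σ φ ⇒ sub σ ψ

record Frame : Set₁ where
  field
    Carrier : Set
    le      : Carrier → Carrier → Bool
    le-refl    : ∀ x → T (le x x)
    le-antisym : ∀ {x y} → T (le x y) → T (le y x) → x ≡ y
    le-trans   : ∀ {x y z} → T (le x y) → T (le y z) → T (le x z)
open Frame public

Leq : (F : Frame) → Carrier F → Carrier F → Set
Leq F x y = T (le F x y)

Lt : (F : Frame) → Carrier F → Carrier F → Set
Lt F x y = Leq F x y × x ≢ y

Finite : Frame → Set
Finite F = Σ (List (Carrier F)) λ xs → ∀ x → x ∈ xs

Valuation : Frame → Set
Valuation F = ℕ → Carrier F → Bool

Persistent : (F : Frame) → Valuation F → Set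
Persistent F V = ∀ p x y → Leq F x y → T (V p x) → T (V p y)

Forces : (F : Frame) → Valuation F → Carrier F → Fm → Set
Forces F V x (var p)  = T (V p x)
Forces F V x ⊥'       = ⊥
Forces F V x (φ ∧' ψ) = Forces F V x φ × Forces F V x ψ
Forces F V x (φ ∨' ψ) = Forces F V x φ ⊎ Forces F V x ψ
Forces F V x (φ ⇒ ψ)  = ∀ y → Leq F x y → Forces F V y φ → Forces F V y ψ

Valid : Frame → Fm → Set
Valid F φ = ∀ (V : Valuation F) → Persistent F V → ∀ x → Forces F V x φ

-- a chain with k+1 elements (i.e. of length k) inside the subset P
ChainIn : (F : Frame) → (Carrier F → Set) → ℕ → Set
ChainIn F P k = Σ (Fin (suc k) → Carrier F) λ c →
  (∀ i → P (c i)) × (∀ (i : Fin k) → Lt F (c (inject₁ i)) (c (fs i)))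

HeightOfSet : (F : Frame) → (Carrier F → Set) → ℕ → Set
HeightOfSet F P h = ChainIn F P h × ¬ ChainIn F P (suc h)

HasHeight : Frame → ℕ → Set
HasHeight F h = HeightOfSet F (λ _ → ⊤) h

HeightAtMost : Frame → ℕ → Set
HeightAtMost F n = ¬ ChainIn F (λ _ → ⊤) (suc n)

ElemHeight : (F : Frame) → Carrier F → ℕ → Set
ElemHeight F x h = HeightOfSet F (λ y → Leq F y x) h

IsTop : (F : Frame) → Carrier F → Set
IsTop F x = ∀ y → Leq F x y → y ≡ x

record FiniteTree (F : Frame) : Set where
  field
    finite : Finite F
    least  : Σ (Carrier F) λ r → ∀ x → Leq F r x
    downChain : ∀ x y z → Leq F y x → Leq F z x → Leq F y z ⊎ Leq F z y

-- A plane ordering of Top(T), given by its enumeration t₁ ≺ ⋯ ≺ t_k (k = suc k')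
record PlaneEnumeration (F : Frame) (k' : ℕ) (t : Fin (suc k') → Carrier F) : Set where
  field
    injective : Injective _≡_ _≡_ t
    tops      : ∀ i → IsTop F (t i)
    onto      : ∀ x → IsTop F x → Σ (Fin (suc k')) λ i → t i ≡ x
    interval  : ∀ x i j l → i ≤ꟳ j → j ≤ꟳ l → Leq F x (t i) → Leq F x (t l) → Leq F x (t j)

module _ (F : Frame) (k' : ℕ) (t : Fin (suc k') → Carrier F) where
  private
    sle : Carrier F ⊎ Fin k' → Carrier F ⊎ Fin k' → Bool
    sle (inj₁ a) (inj₁ b) = le F a b
    sle (inj₁ a) (inj₂ i) = le F a (t (inject₁ i)) ∨ le F a (t (fs i))
    sle (inj₂ i) (inj₁ b) = false
    sle (inj₂ i) (inj₂ j) = ⌊ i ≟ j ⌋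

    srefl : ∀ x → T (sle x x)
    srefl (inj₁ a) = le-refl F a
    srefl (inj₂ i) = fromWitness {a? = i ≟ i} refl

    santi : ∀ {x y} → T (sle x y) → T (sle y x) → x ≡ y
    santi {inj₁ a} {inj₁ b} p q = cong inj₁ (le-antisym F p q)
    santi {inj₁ a} {inj₂ j} p ()
    santi {inj₂ i} {inj₂ j} p q = cong inj₂ (toWitness {a? = i ≟ j} p)

    strans : ∀ {x y z} → T (sle x y) → T (sle y z) → T (sle x z)
    strans {inj₁ a} {inj₁ b} {inj₁ c} p q = le-trans F p q
    strans {inj₁ a} {inj₁ b} {inj₂ k} p q with Equivalence.to T-∨ q
    ... | inj₁ r = Equivalence.from T-∨ (inj₁ (le-trans F p r))
    ... | inj₂ r = Equivalence.from T-∨ (inj₂ (le-trans F p r))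
    strans {inj₁ a} {inj₂ j} {inj₂ k} p q =
      subst (λ m → T (sle (inj₁ a) (inj₂ m))) (toWitness {a? = j ≟ k} q) p
    strans {inj₂ i} {inj₂ j} {inj₂ k} p q =
      fromWitness {a? = i ≟ k}
        (subst (λ m → i ≡ m) (toWitness {a? = j ≟ k} q) (toWitness {a? = i ≟ j} p))

  -- the sawed tree: T plus new points s_i (i : Fin k') with t_i, t_{i+1} < s_i,
  -- order generated by transitivity
  Sawed : Frame
  Sawed = record
    { Carrier = Carrier F ⊎ Fin k'
    ; le = sle
    ; le-refl = srefl
    ; le-antisym = λ {x} {y} → santi {x} {y}
    ; le-trans = λ {x} {y} {z} → strans {x} {y} {z}
    }

-- Jankov–Fine formulas of finite rooted posets (via the Heyting algebra
-- of upsets; the order on Fin m is given by a Boolean table)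

record FinRootedPoset : Set where
  field
    size : ℕ
    ord  : Fin size → Fin size → Bool
    root : Fin size

allSubsets : (m : ℕ) → List (Vec Bool m)
allSubsets zero    = [] ∷ []
allSubsets (suc m) = concatMap (λ v → (false ∷ v) ∷ (true ∷ v) ∷ []) (allSubsets m)

allB : {A : Set} → (A → Bool) → List A → Bool
allB f = foldr (λ x b → f x ∧ b) true

code : ∀ {m} → Vec Bool m → ℕ
code []      = 0
code (b ∷ v) = (if b then 1 else 0) + 2 * code v

module JF (Q : FinRootedPoset) where
  open FinRootedPoset Q
  Sub = Vec Bool size

  isUp : Sub → Bool
  isUp U = allB (λ x → allB (λ y → not (lookup U x ∧ ord x y) ∨ lookup U y) (allFin size)) (allFin size)

  ups : List Sub
  ups = filterᵇ isUp (allSubsets size)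

  meet join imp : Sub → Sub → Sub
  meet = zipWith _∧_
  join = zipWith _∨_
  imp U V = tabulate λ x → allB (λ y → not (ord x y) ∨ not (lookup U y) ∨ lookup V y) (allFin size)

  neg : Sub → Sub
  neg U = imp U (replicate size false)

  -- second greatest upset: Q ∖ {root}
  opremum : Sub
  opremum = tabulate λ x → not ⌊ x ≟ root ⌋

  p : Sub → Fm
  p U = var (code U)

  δ : Fm
  δ = ⋀ (concatMap (λ U → map (λ V →
          (p (meet U V) ⇔' (p U ∧' p V)) ∧'
          (p (join U V) ⇔' (p U ∨' p V)) ∧'
          (p (imp U V)  ⇔' (p U ⇒ p V))) ups) ups)
      ∧' ⋀ (map (λ U → p (neg U) ⇔' ¬' (p U)) ups)

  χ : Fm
  χ = δ ⇒ p opremum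

χ : FinRootedPoset → Fm
χ Q = JF.χ Q

Fork₃ : FinRootedPoset
Fork₃ = record { size = 4 ; ord = λ i j → ⌊ i ≟ j ⌋ ∨ ⌊ i ≟ fz ⌋ ; root = fz }

-- Scott: r = 0, a = 1, b = 2, c = 3 with r < a < b, r < c
Scott : FinRootedPoset
Scott = record
  { size = 4
  ; ord = λ i j → ⌊ i ≟ j ⌋ ∨ ⌊ i ≟ fz ⌋ ∨ (⌊ i ≟ fs fz ⌋ ∧ ⌊ j ≟ fs (fs fz) ⌋)
  ; root = fz }

data IPCAxiom : Fm → Set where
  k   : ∀ φ ψ → IPCAxiom (φ ⇒ ψ ⇒ φ)
  s   : ∀ φ ψ θ → IPCAxiom ((φ ⇒ ψ ⇒ θ) ⇒ (φ ⇒ ψ) ⇒ φ ⇒ θ)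
  ∧e₁ : ∀ φ ψ → IPCAxiom (φ ∧' ψ ⇒ φ)
  ∧e₂ : ∀ φ ψ → IPCAxiom (φ ∧' ψ ⇒ ψ)
  ∧i  : ∀ φ ψ → IPCAxiom (φ ⇒ ψ ⇒ φ ∧' ψ)
  ∨i₁ : ∀ φ ψ → IPCAxiom (φ ⇒ φ ∨' ψ)
  ∨i₂ : ∀ φ ψ → IPCAxiom (ψ ⇒ φ ∨' ψ)
  ∨e  : ∀ φ ψ θ → IPCAxiom ((φ ⇒ θ) ⇒ (ψ ⇒ θ) ⇒ φ ∨' ψ ⇒ θ)
  efq : ∀ φ → IPCAxiom (⊥' ⇒ φ)

BD : ℕ → Fm → Set₁
BD n φ = ∀ (F : Frame) → Finite F → HeightAtMost F n → Valid F φ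

-- PL_n: the smallest intermediate logic containing BD_n ∪ PL, i.e. containing
-- IPC, BD_n, χ(Fork₃), χ(Scott), closed under modus ponens and substitution
data PL : ℕ → Fm → Set₁ where
  ipc   : ∀ {n φ} → IPCAxiom φ → PL n φ
  bd    : ∀ {n φ} → BD n φ → PL n φ
  fork  : ∀ {n} → PL n (χ Fork₃)
  scott : ∀ {n} → PL n (χ Scott)
  mp    : ∀ {n φ ψ} → PL n φ → PL n (φ ⇒ ψ) → PL n ψ
  subst' : ∀ {n φ} (σ : ℕ → Fm) → PL n φ → PL n (sub σ φ)

{-# OPTIONS --safe #-}
module Submission where

-- If χ(Q) fails at a point y of a finite frame of bounded height, the valuation turns the upsets
-- of Q into propositions above y: every top above y gets a colour (a, b or c for Fork₃; b or c
-- for Scott), two distinct colours occur, and the colour of a top m passes to m' whenever some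
-- w ≥ y has upset {w, m, m'} (the remaining colour is then absent from ↑w, so w forces a join
-- that only the colour of m can satisfy).  In a sawed tree the tops above a point of T are the
-- saws s_i, …, s_j over an interval of t's, and consecutive saws s_l, s_{l+1} share the top
-- t_{l+1}, whose upset is {t_{l+1}, s_l, s_{l+1}}; so all tops above y have the same colour, a
-- contradiction.

open import Defs
open import Data.Nat using (ℕ; zero; suc; z≤n; s≤s)
import Data.Nat.Properties as ℕ
open import Data.Bool using (true; false; T)
open import Data.Bool.Properties using (T-∨) renaming (_≟_ to _≟ᵇ_)
open import Data.Fin using (Fin; inject₁; _≤_) renaming (zero to fz; suc to fs)
open import Data.Fin.Properties using (toℕ-inject₁)
import Data.Fin.Properties as Fin
open import Data.Product using (Σ; _×_; _,_; proj₁; proj₂)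
open import Data.Sum using (_⊎_; inj₁; inj₂; map₂; swap)
open import Data.Sum.Properties using (inj₁-injective)
open import Data.Empty using (⊥; ⊥-elim)
open import Data.Unit using (⊤; tt)
open import Data.List using ([]; _∷_; map; _++_; allFin)
open import Data.List.Relation.Unary.All as All using (all?)
open import Data.List.Relation.Unary.Any as Any using (any?; here; there)
open import Data.List.Membership.Propositional using (_∈_; lose)
open import Data.List.Membership.Propositional.Properties using (∈-map⁺; ∈-concatMap⁺; ∈-++⁺ˡ; ∈-++⁺ʳ; ∈-allFin)
open import Data.Vec using ([]; _∷_)
open import Data.Vec.Properties using (≡-dec)
open import Function using (_∘_; id)
open import Function.Bundles using (_⇔_; mk⇔; Equivalence)
open import Function.Properties.Equivalence using () renaming (refl to ⇔-refl; trans to ⇔-trans)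
open import Relation.Nullary using (¬_; Dec; yes; no; _×-dec_; _⊎-dec_; _→-dec_; ¬?)
open import Relation.Nullary.Decidable using (⌊_⌋; toWitness; fromWitness; T?; True; decidable-stable)
open import Relation.Unary using (Decidable)
open import Relation.Binary.PropositionalEquality using (_≡_; refl; sym; trans; cong; subst)

module _ (F : Frame) (V : Valuation F) (P : Persistent F V) where

  forces-mono : ∀ φ {x y} → Leq F x y → Forces F V x φ → Forces F V y φ
  forces-mono (var p)  xy a        = P p _ _ xy a
  forces-mono (φ ∧' ψ) xy (a , b)  = forces-mono φ xy a , forces-mono ψ xy b
  forces-mono (φ ∨' ψ) xy (inj₁ a) = inj₁ (forces-mono φ xy a)
  forces-mono (φ ∨' ψ) xy (inj₂ b) = inj₂ (forces-mono ψ xy b)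
  forces-mono (φ ⇒ ψ)  xy f z yz   = f z (le-trans F xy yz)

  forces-ipcAxiom : ∀ {φ} → IPCAxiom φ → ∀ x → Forces F V x φ
  forces-ipcAxiom (k φ _)    _ _ _ a z yz _ = forces-mono φ yz a
  forces-ipcAxiom (s _ _ _)  _ _ _ f z yz g w zw a = f w (le-trans F yz zw) a w (le-refl F w) (g w zw a)
  forces-ipcAxiom (∧e₁ _ _)  _ _ _ (a , _) = a
  forces-ipcAxiom (∧e₂ _ _)  _ _ _ (_ , b) = b
  forces-ipcAxiom (∧i φ _)   _ _ _ a z yz b = forces-mono φ yz a , b
  forces-ipcAxiom (∨i₁ _ _)  _ _ _ a = inj₁ a
  forces-ipcAxiom (∨i₂ _ _)  _ _ _ b = inj₂ b
  forces-ipcAxiom (∨e _ _ _) _ _ _ f z yz g w zw (inj₁ a) = f w (le-trans F yz zw) a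
  forces-ipcAxiom (∨e _ _ _) _ _ _ f z yz g w zw (inj₂ b) = g w zw b
  forces-ipcAxiom (efq _)    _ _ _ ()

  top-forces-¬ : ∀ φ {m} → IsTop F m → ¬ Forces F V m φ → Forces F V m (¬' φ)
  top-forces-¬ φ {m} top ¬a u mu a with top u mu
  ... | refl = ¬a a

  absent-from-fork : ∀ φ {w m m'} → Leq F w m → (∀ u → Leq F w u → u ≡ w ⊎ u ≡ m ⊎ u ≡ m') →
    ¬ Forces F V m φ → ¬ Forces F V m' φ → Forces F V w (¬' φ)
  absent-from-fork φ wm upset ¬m ¬m' u wu a with upset u wu
  ... | inj₁ refl        = ¬m (forces-mono φ wm a)
  ... | inj₂ (inj₁ refl) = ¬m a
  ... | inj₂ (inj₂ refl) = ¬m' a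

TopAbove : (F : Frame) → Carrier F → Set
TopAbove F x = Σ (Carrier F) λ m → Leq F x m × IsTop F m

valid-mp : ∀ F {φ ψ} → Valid F φ → Valid F (φ ⇒ ψ) → Valid F ψ
valid-mp F a b V P x = b V P x x (le-refl F x) (a V P x)

module FiniteFrame (F : Frame) (fin : Finite F) where

  ∀? : {P : Carrier F → Set} → Decidable P → Dec (∀ x → P x)
  ∀? P? with all? P? (proj₁ fin)
  ... | yes all = yes λ x → All.lookup all (proj₂ fin x)
  ... | no ¬all = no λ all → ¬all (All.tabulate λ {x} _ → all x)

  ∃? : {P : Carrier F → Set} → Decidable P → Dec (Σ (Carrier F) P)
  ∃? P? with any? P? (proj₁ fin)
  ... | yes any = yes (Any.satisfied any)
  ... | no ¬any = no λ (x , px) → ¬any (lose (proj₂ fin x) px)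

  forces? : (V : Valuation F) → ∀ φ → Decidable (λ x → Forces F V x φ)
  forces? V (var p)  x = T? (V p x)
  forces? V ⊥'       x = no λ ()
  forces? V (φ ∧' ψ) x = forces? V φ x ×-dec forces? V ψ x
  forces? V (φ ∨' ψ) x = forces? V φ x ⊎-dec forces? V ψ x
  forces? V (φ ⇒ ψ)  x = ∀? λ y → T? (le F x y) →-dec (forces? V φ y →-dec forces? V ψ y)

  module _ (V : Valuation F) (P : Persistent F V) (σ : ℕ → Fm) where
    open Equivalence using (to; from)

    substituted : Valuation F
    substituted p x = ⌊ forces? V (σ p) x ⌋

    substituted-persistent : Persistent F substituted
    substituted-persistent p x y xy a =
      fromWitness (forces-mono F V P (σ p) xy (toWitness a))

    forces-sub : ∀ φ x → Forces F V x (sub σ φ) ⇔ Forces F substituted x φ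
    forces-sub (var p)  x = mk⇔ fromWitness toWitness
    forces-sub ⊥'       x = mk⇔ (λ ()) (λ ())
    forces-sub (φ ∧' ψ) x = mk⇔
      (λ (a , b) → to (forces-sub φ x) a , to (forces-sub ψ x) b)
      (λ (a , b) → from (forces-sub φ x) a , from (forces-sub ψ x) b)
    forces-sub (φ ∨' ψ) x = mk⇔
      (λ { (inj₁ a) → inj₁ (to (forces-sub φ x) a) ; (inj₂ b) → inj₂ (to (forces-sub ψ x) b) })
      (λ { (inj₁ a) → inj₁ (from (forces-sub φ x) a) ; (inj₂ b) → inj₂ (from (forces-sub ψ x) b) })
    forces-sub (φ ⇒ ψ)  x = mk⇔
      (λ f y xy a → to (forces-sub ψ y) (f y xy (from (forces-sub φ y) a)))
      (λ f y xy a → from (forces-sub ψ y) (f y xy (to (forces-sub φ y) a)))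

  valid-sub : ∀ φ (σ : ℕ → Fm) → Valid F φ → Valid F (sub σ φ)
  valid-sub φ σ v V P x = Equivalence.from (forces-sub V P σ φ x)
    (v (substituted V P σ) (substituted-persistent V P σ) x)

  top-or-chain : ∀ m x → TopAbove F x ⊎ Σ (ChainIn F (λ _ → ⊤) m) λ c → proj₁ c fz ≡ x
  top-or-chain zero x = inj₂ (((λ _ → x) , (λ _ → tt) , λ ()) , refl)
  top-or-chain (suc m) x with ∃? (λ y → T? (le F x y) ×-dec ¬? (T? (le F y x)))
  ... | no nothing-above = inj₁ (x , le-refl F x , maximal)
    where
    maximal : IsTop F x
    maximal y xy = le-antisym F
      (decidable-stable (T? (le F y x)) λ y≰x → nothing-above (y , xy , y≰x)) xy
  ... | yes (y , xy , y≰x) with top-or-chain m y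
  ...   | inj₁ (a , ya , top) = inj₁ (a , le-trans F xy ya , top)
  ...   | inj₂ ((c , _ , c<) , refl) = inj₂ ((x∷c , (λ _ → tt) , x∷c<) , refl)
    where
    x∷c : Fin (suc (suc m)) → Carrier F
    x∷c fz     = x
    x∷c (fs i) = c i
    x∷c< : ∀ i → Lt F (x∷c (inject₁ i)) (x∷c (fs i))
    x∷c< fz     = xy , λ { refl → y≰x (le-refl F x) }
    x∷c< (fs i) = c< i

  top-above : ∀ {n} → HeightAtMost F n → ∀ x → TopAbove F x
  top-above {n} bounded x with top-or-chain (suc n) x
  ... | inj₁ top       = top
  ... | inj₂ (c , _)   = ⊥-elim (bounded c)

  unrefuted-forced-at-top : ∀ {n} → HeightAtMost F n → (V : Valuation F) → Persistent F V →
    ∀ φ y → ¬ Forces F V y (¬' φ) → Σ (Carrier F) λ m → Leq F y m × IsTop F m × Forces F V m φ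
  unrefuted-forced-at-top bounded V P φ y unrefuted
    with ∃? (λ u → T? (le F y u) ×-dec forces? V φ u)
  ... | no none = ⊥-elim (unrefuted λ u yu a → none (u , yu , a))
  ... | yes (u , yu , a) with top-above bounded u
  ...   | m , um , top = m , le-trans F yu um , top , forces-mono F V P φ um a

forces-⋀ : ∀ {F V x φ} L → Forces F V x (⋀ L) → φ ∈ L → Forces F V x φ
forces-⋀ (_ ∷ _) (a , _) (here refl) = a
forces-⋀ (_ ∷ L) (_ , b) (there φ∈L) = forces-⋀ L b φ∈L

module JankovFine (Q : FinRootedPoset) (F : Frame) (V : Valuation F) (P : Persistent F V)
                  (y : Carrier F) (y⊩δ : Forces F V y (JF.δ Q)) where
  open JF Q public
  open FinRootedPoset Q using (size)
  open import Data.List.Membership.DecPropositional (≡-dec {n = size} _≟ᵇ_) using (_∈?_)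

  Holds : Sub → Carrier F → Set
  Holds U u = Forces F V u (p U)

  Holds-mono : ∀ U {u v} → Leq F u v → Holds U u → Holds U v
  Holds-mono U = forces-mono F V P (p U)

  -- For a concrete upset U this reduces to ⊤, so implicit arguments of this type are solved by η.
  Upset : Sub → Set
  Upset U = True (U ∈? ups)

  module _ (U W : Sub) {U↑ : Upset U} {W↑ : Upset W} {u : Carrier F} (yu : Leq F y u) where
    private
      law : Fm
      law = (p (meet U W) ⇔' (p U ∧' p W)) ∧' (p (join U W) ⇔' (p U ∨' p W)) ∧' (p (imp U W) ⇔' (p U ⇒ p W))
      algebra : Forces F V u law
      algebra = forces-mono F V P law yu (forces-⋀ {φ = law} _ (proj₁ y⊩δ)
        (∈-concatMap⁺ _ (Any.map (λ { refl → ∈-map⁺ _ (toWitness W↑) }) (toWitness U↑))))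
    meet-intro : Holds U u → Holds W u → Holds (meet U W) u
    meet-intro a b = proj₂ (proj₁ algebra) u (le-refl F u) (a , b)
    join-elim : Holds (join U W) u → Holds U u ⊎ Holds W u
    join-elim = proj₁ (proj₁ (proj₂ algebra)) u (le-refl F u)
    join-intro : Holds U u ⊎ Holds W u → Holds (join U W) u
    join-intro = proj₂ (proj₁ (proj₂ algebra)) u (le-refl F u)
    imp-intro : Forces F V u (p U ⇒ p W) → Holds (imp U W) u
    imp-intro = proj₂ (proj₂ (proj₂ algebra)) u (le-refl F u)

  module _ (U : Sub) {U↑ : Upset U} {u : Carrier F} (yu : Leq F y u) where
    private
      law : Fm
      law = p (neg U) ⇔' ¬' (p U)
      negation : Forces F V u law
      negation = forces-mono F V P law yu (forces-⋀ {φ = law} _ (proj₂ y⊩δ) (∈-map⁺ _ (toWitness U↑)))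
    neg-elim : Holds (neg U) u → Holds U u → ⊥
    neg-elim n a = proj₁ negation u (le-refl F u) n u (le-refl F u) a
    neg-intro : Forces F V u (¬' (p U)) → Holds (neg U) u
    neg-intro = proj₂ negation u (le-refl F u)

  bottom-unforced : ∀ U {U↑ : Upset U} {U⇒U↑ : Upset (imp U U)} {u} → Leq F y u → ¬ Holds (neg (imp U U)) u
  bottom-unforced U {U↑} {U⇒U↑} yu h =
    neg-elim (imp U U) {U⇒U↑} yu h (imp-intro U U {U↑} {U↑} yu λ _ _ a → a)

  forced-at-top : ∀ U {U↑ : Upset U} {m} → Leq F y m → IsTop F m → ¬ Holds (neg U) m → Holds U m
  forced-at-top U {U↑} {m} ym top ¬U∁ = decidable-stable (T? (V (code U) m))
    λ ¬a → ¬U∁ (neg-intro U {U↑} ym (top-forces-¬ F V P (p U) top ¬a))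

  not-refuted : ∀ U {U↑ : Upset U} {U∁↑ : Upset (neg U)} →
    ¬ Holds (join U (neg U)) y → ¬ Forces F V y (¬' (p U))
  not-refuted U {U↑} {U∁↑} ¬U∨U∁ refuted = ¬U∨U∁ (join-intro U (neg U) {U↑} {U∁↑} (le-refl F y)
    (inj₂ (neg-intro U {U↑} (le-refl F y) refuted)))

valid-χ : ∀ F Q → (∀ V → Persistent F V → ∀ y → Forces F V y (JF.δ Q) → ¬ Forces F V y (JF.p Q (JF.opremum Q)) → ⊥)
        → Valid F (χ Q)
valid-χ F Q refute V P x y xy y⊩δ = decidable-stable (T? _) (refute V P y y⊩δ)

⇔-along : ∀ {n} (P : Fin (suc n) → Set) {i j : Fin (suc n)} → i ≤ j →
  (∀ g → i ≤ inject₁ g → fs g ≤ j → P (inject₁ g) ⇔ P (fs g)) → P i ⇔ P j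
⇔-along P {fz} {fz} _ _ = ⇔-refl
⇔-along {zero} P {fz} {fs ()}
⇔-along {suc n} P {fz} {fs j} _ step =
  ⇔-trans (step fz z≤n (s≤s z≤n)) (⇔-along (P ∘ fs) {fz} {j} z≤n λ g _ g<j → step (fs g) z≤n (s≤s g<j))
⇔-along {suc n} P {fs i} {fs j} (s≤s i≤j) step =
  ⇔-along (P ∘ fs) i≤j λ g i≤g g<j → step (fs g) (s≤s i≤g) (s≤s g<j)

ForkInvariant : (F : Frame) → (Carrier F → Set) → Carrier F → Set
ForkInvariant F X y = ∀ w m m' → Leq F y w → Leq F w m → Leq F w m' → IsTop F m → IsTop F m'
  → (∀ u → Leq F w u → u ≡ w ⊎ u ≡ m ⊎ u ≡ m') → X m → X m'

module SawedTree (T : Frame) {k'} (t : Fin (suc k') → Carrier T) (PE : PlaneEnumeration T k' t) where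
  open PlaneEnumeration PE

  S : Frame
  S = Sawed T k' t

  sawed-finite : Finite T → Finite S
  sawed-finite (xs , xs-complete) = map inj₁ xs ++ map inj₂ (allFin k') , complete
    where
    complete : ∀ u → u ∈ map inj₁ xs ++ map inj₂ (allFin k')
    complete (inj₁ a) = ∈-++⁺ˡ (∈-map⁺ inj₁ (xs-complete a))
    complete (inj₂ j) = ∈-++⁺ʳ (map inj₁ xs) (∈-map⁺ inj₂ (∈-allFin j))

  saw-top : ∀ j → IsTop S (inj₂ j)
  saw-top j (inj₂ j') j≡j' = cong inj₂ (sym (toWitness j≡j'))

  top-index : ∀ {a} → IsTop S (inj₁ a) → Σ (Fin (suc k')) λ i → t i ≡ a
  top-index {a} top = onto a λ b ab → inj₁-injective (top (inj₁ b) ab)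

  below-saw : ∀ {x} j → Leq S (inj₁ x) (inj₂ j) → Σ (Fin (suc k')) λ a → j ≤ a × a ≤ fs j × Leq T x (t a)
  below-saw j x≤s with Equivalence.to T-∨ x≤s
  ... | inj₁ x≤t = inject₁ j , ℕ.≤-reflexive (sym (toℕ-inject₁ j))
                 , ℕ.≤-trans (ℕ.≤-reflexive (toℕ-inject₁ j)) (ℕ.n≤1+n _) , x≤t
  ... | inj₂ x≤t = fs j , ℕ.n≤1+n _ , ℕ.≤-refl , x≤t

module SawedTree⁺ (T : Frame) {k} (t : Fin (suc (suc k)) → Carrier T) (PE : PlaneEnumeration T (suc k) t) where
  open PlaneEnumeration PE
  open SawedTree T t PE

  no-top-in-T : ∀ {a} → ¬ IsTop S (inj₁ a)
  no-top-in-T {a} top with top-index top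
  ... | fz   , refl with () ← top (inj₂ fz) (Equivalence.from T-∨ (inj₁ (le-refl T a)))
  ... | fs j , refl with () ← top (inj₂ j) (Equivalence.from T-∨ (inj₂ (le-refl T a)))

  fork-point : Fin k → Carrier S
  fork-point g = inj₁ (t (fs (inject₁ g)))

  fork-point-upset : ∀ g u → Leq S (fork-point g) u →
    u ≡ fork-point g ⊎ u ≡ inj₂ (inject₁ g) ⊎ u ≡ inj₂ (fs g)
  fork-point-upset g (inj₁ b) w≤b = inj₁ (cong inj₁ (tops _ b w≤b))
  fork-point-upset g (inj₂ j) w≤s with Equivalence.to T-∨ w≤s
  ... | inj₁ w≤t = inj₂ (inj₂ (cong inj₂ (next (injective (tops (fs (inject₁ g)) _ w≤t)))))
    where
    next : ∀ {j} → inject₁ j ≡ fs (inject₁ g) → j ≡ fs g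
    next {fs j} eq = cong fs (Fin.inject₁-injective (Fin.suc-injective eq))
  ... | inj₂ w≤t = inj₂ (inj₁ (cong inj₂ (Fin.suc-injective (injective (tops (fs (inject₁ g)) _ w≤t)))))

  fork-step : ∀ X {x} → ForkInvariant S X (inj₁ x) → ∀ {i j : Fin (suc k)} {a b} → a ≤ fs i → j ≤ b →
    Leq T x (t a) → Leq T x (t b) → ∀ g → i ≤ inject₁ g → fs g ≤ j → X (inj₂ (inject₁ g)) ⇔ X (inj₂ (fs g))
  fork-step X {x} inv {a = a} {b} a≤i+1 j≤b x≤a x≤b g i≤g g<j = mk⇔
    (inv w _ _ x≤w w≤left w≤right (saw-top _) (saw-top _) (fork-point-upset g))
    (inv w _ _ x≤w w≤right w≤left (saw-top _) (saw-top _) (λ u w≤u → map₂ swap (fork-point-upset g u w≤u)))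
    where
    w : Carrier S
    w = fork-point g
    x≤w : Leq S (inj₁ x) w
    x≤w = interval x a (fs (inject₁ g)) b (ℕ.≤-trans a≤i+1 (s≤s i≤g))
            (ℕ.≤-trans (ℕ.≤-reflexive (cong suc (toℕ-inject₁ g))) (ℕ.≤-trans g<j j≤b)) x≤a x≤b
    w≤left : Leq S w (inj₂ (inject₁ g))
    w≤left = Equivalence.from T-∨ (inj₂ (le-refl T _))
    w≤right : Leq S w (inj₂ (fs g))
    w≤right = Equivalence.from T-∨ (inj₁ (le-refl T _))

  tops-connected : ∀ X {y m₁ m₂} → ForkInvariant S X y → Leq S y m₁ → IsTop S m₁ →
    Leq S y m₂ → IsTop S m₂ → X m₁ → X m₂
  tops-connected X {m₁ = inj₁ _} _ _ top₁ _ _ = ⊥-elim (no-top-in-T top₁)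
  tops-connected X {m₂ = inj₁ _} _ _ _ _ top₂ = ⊥-elim (no-top-in-T top₂)
  tops-connected X {inj₂ j} {inj₂ j₁} {inj₂ j₂} _ j≡j₁ _ j≡j₂ _ =
    subst (X ∘ inj₂) (trans (sym (toWitness j≡j₁)) (toWitness j≡j₂))
  tops-connected X {inj₁ x} {inj₂ j₁} {inj₂ j₂} inv x≤s₁ _ x≤s₂ _
    with below-saw j₁ x≤s₁ | below-saw j₂ x≤s₂ | Fin.≤-total j₁ j₂
  ... | a₁ , _ , a₁≤j₁+1 , x≤a₁ | a₂ , j₂≤a₂ , _ , x≤a₂ | inj₁ j₁≤j₂ =
    Equivalence.to (⇔-along (X ∘ inj₂) j₁≤j₂ (fork-step X inv a₁≤j₁+1 j₂≤a₂ x≤a₁ x≤a₂))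
  ... | a₁ , j₁≤a₁ , _ , x≤a₁ | a₂ , _ , a₂≤j₂+1 , x≤a₂ | inj₂ j₂≤j₁ =
    Equivalence.from (⇔-along (X ∘ inj₂) j₂≤j₁ (fork-step X inv a₂≤j₂+1 j₁≤a₁ x≤a₂ x≤a₁))

TopsConnected : Frame → Set₁
TopsConnected F = ∀ (X : Carrier F → Set) {y m₁ m₂} → ForkInvariant F X y →
  Leq F y m₁ → IsTop F m₁ → Leq F y m₂ → IsTop F m₂ → X m₁ → X m₂

sawed-tops-connected : ∀ (T : Frame) {k'} (t : Fin (suc k') → Carrier T) → PlaneEnumeration T k' t →
  TopsConnected (Sawed T k' t)
sawed-tops-connected T {zero} t PE X {m₁ = inj₁ _} {inj₁ _} _ _ top₁ _ top₂
  with SawedTree.top-index T t PE top₁ | SawedTree.top-index T t PE top₂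
... | fz , refl | fz , refl = id
sawed-tops-connected T {suc _} t PE = SawedTree⁺.tops-connected T t PE

module _ (F : Frame) (fin : Finite F) {n} (bounded : HeightAtMost F n) (connected : TopsConnected F) where
  open FiniteFrame F fin using (unrefuted-forced-at-top)

  module Fork₃-refutation (V : Valuation F) (P : Persistent F V) (y : Carrier F)
                          (y⊩δ : Forces F V y (JF.δ Fork₃)) where
    open JankovFine Fork₃ F V P y y⊩δ

    -- Points are listed as root, 1, 2, 3.  The Heyting operations on these closed vectors
    -- normalise, so e.g. a goal about p (neg c) is one about p ab, and p opremum is p abc.
    ∅ a b c ab ac bc abc : Sub
    ∅   = false ∷ false ∷ false ∷ false ∷ []
    a   = false ∷ true  ∷ false ∷ false ∷ []
    b   = false ∷ false ∷ true  ∷ false ∷ []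
    c   = false ∷ false ∷ false ∷ true  ∷ []
    ab  = false ∷ true  ∷ true  ∷ false ∷ []
    ac  = false ∷ true  ∷ false ∷ true  ∷ []
    bc  = false ∷ false ∷ true  ∷ true  ∷ []
    abc = false ∷ true  ∷ true  ∷ true  ∷ []

    empty : ∀ {u} → Leq F y u → ¬ Holds ∅ u
    empty = bottom-unforced ∅

    disjoint : ∀ U W {U↑ : Upset U} {W↑ : Upset W} {u} → meet U W ≡ ∅ → Leq F y u → Holds U u → Holds W u → ⊥
    disjoint U W {U↑} {W↑} U∧W≡∅ yu hU hW = empty yu (subst (λ Z → Holds Z _) U∧W≡∅ (meet-intro U W {U↑} {W↑} yu hU hW))

    colour-of-top : ∀ {m} → Leq F y m → IsTop F m → Holds a m ⊎ Holds b m ⊎ Holds c m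
    colour-of-top ym top with join-elim ab c ym (forced-at-top abc ym top (empty ym))
    ... | inj₂ cm = inj₂ (inj₂ cm)
    ... | inj₁ abm with join-elim a b ym abm
    ...   | inj₁ am = inj₁ am
    ...   | inj₂ bm = inj₂ (inj₁ bm)

    a-fork-invariant : ForkInvariant F (Holds a) y
    a-fork-invariant w m m' yw wm wm' _ top' upset am
      with colour-of-top (le-trans F yw wm') top'
    ... | inj₁ am' = am'
    ... | inj₂ (inj₁ bm')
      with join-elim a b yw (neg-intro c yw (absent-from-fork F V P (p c) wm upset
             (disjoint a c refl (le-trans F yw wm) am) (disjoint b c refl (le-trans F yw wm') bm')))
    ...   | inj₁ aw = Holds-mono a wm' aw
    ...   | inj₂ bw = ⊥-elim (disjoint a b refl (le-trans F yw wm) am (Holds-mono b wm bw))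
    a-fork-invariant w m m' yw wm wm' _ top' upset am | inj₂ (inj₂ cm')
      with join-elim a c yw (neg-intro b yw (absent-from-fork F V P (p b) wm upset
             (disjoint a b refl (le-trans F yw wm) am) (λ bm' → disjoint b c refl (le-trans F yw wm') bm' cm')))
    ...   | inj₁ aw = Holds-mono a wm' aw
    ...   | inj₂ cw = ⊥-elim (disjoint a c refl (le-trans F yw wm) am (Holds-mono c wm cw))

    refute : ¬ Holds abc y → ⊥
    refute ¬abc with unrefuted-forced-at-top bounded V P (p a) y (not-refuted a ¬abc)
                   | unrefuted-forced-at-top bounded V P (p b) y (not-refuted b ¬abc)
    ... | ma , yma , tma , am | mb , ymb , tmb , bm =
      disjoint a b refl ymb (connected (Holds a) a-fork-invariant yma tma ymb tmb am) bm

  module Scott-refutation (V : Valuation F) (P : Persistent F V) (y : Carrier F)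
                          (y⊩δ : Forces F V y (JF.δ Scott)) where
    open JankovFine Scott F V P y y⊩δ

    ∅ b c ab bc abc : Sub
    ∅   = false ∷ false ∷ false ∷ false ∷ []
    b   = false ∷ false ∷ true  ∷ false ∷ []
    c   = false ∷ false ∷ false ∷ true  ∷ []
    ab  = false ∷ true  ∷ true  ∷ false ∷ []
    bc  = false ∷ false ∷ true  ∷ true  ∷ []
    abc = false ∷ true  ∷ true  ∷ true  ∷ []

    empty : ∀ {u} → Leq F y u → ¬ Holds ∅ u
    empty = bottom-unforced ∅

    b∧c-unforced : ∀ {u} → Leq F y u → Holds b u → Holds c u → ⊥
    b∧c-unforced yu bu cu = empty yu (meet-intro b c yu bu cu)

    colour-of-top : ∀ {m} → Leq F y m → IsTop F m → Holds b m ⊎ Holds c m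
    colour-of-top ym top = join-elim b c ym (forced-at-top bc ym top (empty ym))

    b-fork-invariant : ForkInvariant F (Holds b) y
    b-fork-invariant w m m' yw wm wm' _ top' upset bm
      with colour-of-top (le-trans F yw wm') top'
    ... | inj₁ bm' = bm'
    ... | inj₂ cm' with join-elim b c yw (imp-intro ab b yw ab⇒b)
      where
      ab⇒b : ∀ v → Leq F w v → Holds ab v → Holds b v
      ab⇒b v wv abv with upset v wv
      ... | inj₁ refl        = ⊥-elim (neg-elim c (le-trans F yw wm') (Holds-mono ab wm' abv) cm')
      ... | inj₂ (inj₁ refl) = bm
      ... | inj₂ (inj₂ refl) = ⊥-elim (neg-elim c (le-trans F yw wm') abv cm')
    ...   | inj₁ bw = Holds-mono b wm' bw
    ...   | inj₂ cw = ⊥-elim (b∧c-unforced (le-trans F yw wm) bm (Holds-mono c wm cw))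

    refute : ¬ Holds abc y → ⊥
    refute ¬abc with unrefuted-forced-at-top bounded V P (p ab) y (not-refuted ab ¬abc)
                   | unrefuted-forced-at-top bounded V P (p c) y (not-refuted c ¬abc)
    ... | mb , ymb , tmb , abm | mc , ymc , tmc , cm with colour-of-top ymb tmb
    ...   | inj₂ cmb = neg-elim c ymb abm cmb
    ...   | inj₁ bm = b∧c-unforced ymc (connected (Holds b) b-fork-invariant ymb tmb ymc tmc bm) cm

  fork₃-valid : Valid F (χ Fork₃)
  fork₃-valid = valid-χ F Fork₃ λ V P y y⊩δ → Fork₃-refutation.refute V P y y⊩δ

  scott-valid : Valid F (χ Scott)
  scott-valid = valid-χ F Scott λ V P y y⊩δ → Scott-refutation.refute V P y y⊩δ

  PL-sound : ∀ {φ} → PL n φ → Valid F φ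
  PL-sound (ipc ax)              V P = forces-ipcAxiom F V P ax
  PL-sound (bd BDφ)              = BDφ F fin bounded
  PL-sound fork                  = fork₃-valid
  PL-sound scott                 = scott-valid
  PL-sound (mp {φ = φ} {ψ} PLφ PLφ⇒ψ) = valid-mp F {φ} {ψ} (PL-sound PLφ) (PL-sound PLφ⇒ψ)
  PL-sound (subst' {φ = φ} σ PLφ) = FiniteFrame.valid-sub F fin φ σ (PL-sound PLφ)

lemma7p7 : (T : Frame) → FiniteTree T
    → Σ ℕ (λ h → HasHeight T (suc h))
    → (∀ x y h → IsTop T x → IsTop T y → ElemHeight T x h → ElemHeight T y h)
    → (k' : ℕ) (t : Fin (suc k') → Carrier T) → PlaneEnumeration T k' t
    → (n : ℕ) → HasHeight (Sawed T k' t) n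
    → ∀ φ → PL n φ → Valid (Sawed T k' t) φ
lemma7p7 T tree _ _ k' t PE n (_ , bounded) φ =
  PL-sound (Sawed T k' t) (SawedTree.sawed-finite T t PE (FiniteTree.finite tree)) bounded
    (sawed-tops-connected T t PE)
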